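{- Let $n\ge 4$ be an even integer, $\mathrm{D}_{2n}=\langle a,b\mid a^n=b^2=1,\ abab=1\rangle$, $S=\{a,a^{ -1},ab,a^{\frac n2+1}b\}$ and $\Gamma=\mathrm{Cay}(\mathrm{D}_{2n},S)$. Then $S$ is not a CI-subset of $\mathrm{D}_{2n}$, and if $n>4$ then $R(\mathrm{D}_{2n})$ is a normal subgroup of $\mathrm{Aut}(\Gamma)$.
   Context: For a finite group $G$ and $S\subseteq G\setminus\{1\}$, $\mathrm{Cay}(G,S)$ is the digraph with vertex set $G$ and arcs $(x,y)$ with $yx^{ -1}\in S$. $S$ is a CI-subset of $G$ if for every $T\subseteq G\setminus\{1\}$ with $\mathrm{Cay}(G,S)\cong\mathrm{Cay}(G,T)$ there is $\sigma\in\mathrm{Aut}(G)$ with $S^\sigma=T$. For $g\in G$, $R(g)$ is the permutation $x\mapsto xg$ of $G$, and $R(G)=\{R(g)\mid g\in G\}$, a subgroup of $\mathrm{Aut}(\mathrm{Cay}(G,S))$. -}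

module Defs where

open import Data.Nat using (ℕ; zero; suc; _+_; _∸_; NonZero)
open import Data.Nat.DivMod using (_mod_; _/_)
open import Data.Fin using (Fin; toℕ)
open import Data.Bool using (Bool; true; false; _xor_)
open import Data.Product using (_×_; _,_; Σ; ∃)
open import Relation.Binary.PropositionalEquality using (_≡_)
open import Function.Bundles using (_↔_; Inverse)

-- The dihedral group D_{2n} = ⟨a, b | aⁿ = b² = 1, abab = 1⟩ of order 2n,
-- realised concretely: the pair (i , e) stands for the normal form a^i b^e
-- (i ∈ ℤ/n, e = false ↦ b⁰, e = true ↦ b¹).
-- From abab = 1 we get b a^j = a^{-j} b, hence
--   (a^i b^e)(a^j b^f) = a^{i + (-1)^e j} b^{e+f}.
D : (n : ℕ) → Set
D n = Fin n × Bool

module _ {n : ℕ} .{{_ : NonZero n}} where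

  negF : Fin n → Fin n
  negF i = (n ∸ toℕ i) mod n

  addF : Fin n → Fin n → Fin n
  addF i j = (toℕ i + toℕ j) mod n

  _·_ : D n → D n → D n
  (i , false) · (j , f) = (addF i j , f)
  (i , true)  · (j , f) = (addF i (negF j) , true xor f)

  one : D n
  one = (0 mod n , false)

  inv : D n → D n
  inv (i , false) = (negF i , false)
  inv (i , true)  = (i , true)

  aPow : ℕ → D n
  aPow k = (k mod n , false)

  a : D n
  a = aPow 1

  b : D n
  b = (0 mod n , true)

  Subset : Set
  Subset = D n → Bool

  arc : Subset → D n → D n → Bool
  arc S x y = S (y · inv x)

  CayIso : Subset → Subset → Set
  CayIso S T = Σ (D n ↔ D n) λ φ →
    ∀ x y → arc T (Inverse.to φ x) (Inverse.to φ y) ≡ arc S x y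

  IsCayAut : Subset → (D n ↔ D n) → Set
  IsCayAut S φ = ∀ x y → arc S (Inverse.to φ x) (Inverse.to φ y) ≡ arc S x y

  IsGroupAut : (D n ↔ D n) → Set
  IsGroupAut σ = ∀ x y → Inverse.to σ (x · y) ≡ Inverse.to σ x · Inverse.to σ y

  ImageEq : (D n ↔ D n) → Subset → Subset → Set
  ImageEq σ S T = ∀ x → T (Inverse.to σ x) ≡ S x

  IsCI : Subset → Set
  IsCI S = ∀ (T : Subset) → T one ≡ false → CayIso S T →
    Σ (D n ↔ D n) λ σ → IsGroupAut σ × ImageEq σ S T

  -- R(g) : x ↦ x g.  R(D_{2n}) is normal in Aut(Cay(D_{2n},S)):
  -- for every automorphism φ and every g there is h with
  -- φ ∘ R(g) ∘ φ⁻¹ = R(h).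
  RegularNormal : Subset → Set
  RegularNormal S = ∀ (φ : D n ↔ D n) → IsCayAut S φ → ∀ (g : D n) →
    ∃ λ (h : D n) → ∀ x → Inverse.to φ (Inverse.from φ x · g) ≡ x · h

  open import Data.Fin using (_≟_)
  open import Data.Bool using (_∨_; _∧_)
  open import Relation.Nullary.Decidable using (⌊_⌋)
  import Data.Bool as B

  eqD : D n → D n → Bool
  eqD (i , e) (j , f) = ⌊ i ≟ j ⌋ ∧ ⌊ e B.≟ f ⌋

  S₀ : Subset
  S₀ x = eqD x a ∨ eqD x (inv a) ∨ eqD x (a · b) ∨ eqD x (aPow (n / 2 + 1) · b)

{-# OPTIONS --safe #-}
module Submission where

-- Since n is even, the parity of the exponent of a is a homomorphism χ onto ℤ/2, and the
-- involution x ↦ (ab)^χ(x) x of D_{2n} maps Cay(S) isomorphically onto Cay(T), T the image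
-- of S, because conjugation by ab preserves S.  Every element of T is an involution while a
-- is not, so no automorphism of D_{2n} maps S onto T.
--
-- For normality let f be a graph automorphism; δ u x = f (u x) · f x ⁻¹ lies in S whenever u
-- does.  The vertices a x and a⁻¹ x have x as their only common out-neighbour, and for n > 4
-- no other pair of distinct elements of S has this property, so δ a x ∈ {a, a⁻¹} with
-- δ a⁻¹ x = (δ a x)⁻¹, and δ (ab) x ∈ {ab, a^(n/2+1) b}.  The cocycle identity
-- δ (u v) x = δ u (v x) · δ v x applied to a⁻¹ a = 1, (ab)² = 1 and (ab) a = a⁻¹ (ab), together
-- with a^(n/2) ∉ {1, a², a⁻²}, shows that δ a and δ (ab) are invariant under left
-- multiplication by a and ab, hence constant.  Then f (x y) = f x · f 1 ⁻¹ · f y, that is,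
-- f ∘ R(g) ∘ f⁻¹ = R(f 1 ⁻¹ · f g).

open import Defs
open import Data.Nat using (ℕ; _≤_; _<_; NonZero)
open import Data.Nat.Divisibility using (_∣_; divides)
open import Data.Product using (_×_)
open import Relation.Nullary using (¬_)

open import Algebra.Bundles using (Group; CommutativeRing)
import Algebra.Properties.CommutativeSemigroup as CommutativeSemigroupProperties
import Algebra.Properties.Group as GroupProperties
open import Algebra.Structures using (IsGroup)
open import Data.Bool using (Bool; true; false; not; _xor_; _∨_)
import Data.Bool.Properties as Bool
open import Data.Empty using (⊥; ⊥-elim)
open import Data.Fin using (Fin; toℕ; fromℕ<; zero; suc)
import Data.Fin.Properties as Fin
open import Data.Integer as ℤ using (ℤ; +_; -[1+_]; _+_; _*_; -_; _-_; 0ℤ; 1ℤ; -1ℤ; ∣_∣)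
open import Data.Integer.DivMod using (_%ℕ_; _/ℕ_; n%ℕd<d; a≡a%ℕn+[a/ℕn]*n)
open import Data.Integer.Divisibility.Signed using (divides; ∣⇒∣ᵤ; ∣m⇒∣-m; ∣m∣n⇒∣m+n; ∣-trans)
  renaming (_∣_ to _∣ℤ_)
import Data.Integer.Properties as ℤ
open import Data.Integer.Tactic.RingSolver using (solve-∀)
open import Data.Nat as ℕ using (zero; suc; s≤s; z≤n)
open import Data.Nat.DivMod using (_/_; m*n/n≡m)
import Data.Nat.Divisibility as ℕ
import Data.Nat.Properties as ℕ
open import Data.Nat.Tactic.RingSolver using () renaming (solve-∀ to ℕ-solve-∀)
open import Data.Product using (Σ; _,_; proj₁; proj₂)
open import Data.Sum using (_⊎_; inj₁; inj₂; [_,_]′)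
open import Function.Bundles using (_↔_; Inverse; Injection; mk⇔; mk↔ₛ′)
open import Function.Properties.Inverse using (↔⇒↣)
open import Relation.Binary.PropositionalEquality
open import Relation.Nullary using (yes; no)
open ≡-Reasoning

∨-elim : ∀ x {y} → x ∨ y ≡ true → x ≡ true ⊎ y ≡ true
∨-elim true  _   = inj₁ refl
∨-elim false y≡t = inj₂ y≡t

∨-introˡ : ∀ {x} y → x ≡ true → x ∨ y ≡ true
∨-introˡ y refl = refl

∨-introʳ : ∀ x {y} → y ≡ true → x ∨ y ≡ true
∨-introʳ x refl = Bool.∨-zeroʳ x

xor-interchange : ∀ p q e f → (p xor q) xor (e xor f) ≡ (p xor e) xor (q xor f)
xor-interchange = CommutativeSemigroupProperties.interchange
  (CommutativeRing.+-commutativeSemigroup Bool.xor-∧-commutativeRing)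

module Modular (n : ℕ) .{{_ : NonZero n}} where

  infix 4 _≈_
  record _≈_ (x y : ℤ) : Set where
    constructor n∣-
    field n∣x-y : + n ∣ℤ x - y

  ≈-by : ∀ {u x y} → + n ∣ℤ u → u ≡ x - y → x ≈ y
  ≈-by n∣u refl = n∣- n∣u

  ≈-reflexive : ∀ {x y} → x ≡ y → x ≈ y
  ≈-reflexive {x} refl = ≈-by (divides 0ℤ refl) (sym (ℤ.+-inverseʳ x))

  ≈-sym : ∀ {x y} → x ≈ y → y ≈ x
  ≈-sym {x} {y} (n∣- p) = ≈-by (∣m⇒∣-m p) (lemma x y)
    where
    lemma : ∀ x y → - (x - y) ≡ y - x
    lemma = solve-∀

  ≈-trans : ∀ {x y z} → x ≈ y → y ≈ z → x ≈ z
  ≈-trans {x} {y} {z} (n∣- p) (n∣- q) = ≈-by (∣m∣n⇒∣m+n p q) (lemma x y z)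
    where
    lemma : ∀ x y z → (x - y) + (y - z) ≡ x - z
    lemma = solve-∀

  +-cong-≈ : ∀ {x x′ y y′} → x ≈ x′ → y ≈ y′ → x + y ≈ x′ + y′
  +-cong-≈ {x} {x′} {y} {y′} (n∣- p) (n∣- q) = ≈-by (∣m∣n⇒∣m+n p q) (lemma x x′ y y′)
    where
    lemma : ∀ x x′ y y′ → (x - x′) + (y - y′) ≡ (x + y) - (x′ + y′)
    lemma = solve-∀

  neg-cong-≈ : ∀ {x y} → x ≈ y → - x ≈ - y
  neg-cong-≈ {x} {y} (n∣- p) = ≈-by (∣m⇒∣-m p) (lemma x y)
    where
    lemma : ∀ x y → - (x - y) ≡ - x - - y
    lemma = solve-∀

  ≈-refl : ∀ {x} → x ≈ x
  ≈-refl = ≈-reflexive refl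

  n≈0 : + n ≈ 0ℤ
  n≈0 = ≈-by (divides 1ℤ (sym (ℤ.*-identityˡ (+ n)))) (sym (ℤ.+-identityʳ (+ n)))

  x+n≈x : ∀ x → x + + n ≈ x
  x+n≈x x = ≈-trans (+-cong-≈ (≈-refl {x}) n≈0) (≈-reflexive (ℤ.+-identityʳ x))

  n∣x∧∣x∣<n⇒x≡0 : ∀ {x} → + n ∣ℤ x → ∣ x ∣ ℕ.< n → x ≡ 0ℤ
  n∣x∧∣x∣<n⇒x≡0 {x} n∣x ∣x∣<n with ∣ x ∣ in ∣x∣≡
  ... | zero  = ℤ.∣i∣≡0⇒i≡0 ∣x∣≡
  ... | suc _ = ⊥-elim (ℕ.<⇒≱ ∣x∣<n (ℕ.∣⇒≤ (subst (n ℕ.∣_) ∣x∣≡ (∣⇒∣ᵤ n∣x))))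

  residue : ℤ → Fin n
  residue x = fromℕ< (n%ℕd<d x n)

  residue-≈ : ∀ x → + toℕ (residue x) ≈ x
  residue-≈ x rewrite Fin.toℕ-fromℕ< (n%ℕd<d x n) =
    ≈-sym (n∣- (divides (x /ℕ n) (trans (cong (_- r) (a≡a%ℕn+[a/ℕn]*n x n)) (lemma r (x /ℕ n) (+ n)))))
    where
    r = + (x %ℕ n)
    lemma : ∀ r q d → (r + q * d) - r ≡ q * d
    lemma = solve-∀

  toℕ-injective-≈ : ∀ {i j : Fin n} → + toℕ i ≈ + toℕ j → i ≡ j
  toℕ-injective-≈ {i} {j} (n∣- n∣i-j) =
    Fin.toℕ-injective (ℤ.+-injective (ℤ.i-j≡0⇒i≡j _ _ (n∣x∧∣x∣<n⇒x≡0 n∣i-j ∣i-j∣<n)))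
    where
    ∣i-j∣<n : ∣ + toℕ i - + toℕ j ∣ ℕ.< n
    ∣i-j∣<n = subst (ℕ._< n) (sym (cong ∣_∣ (ℤ.m-n≡m⊖n (toℕ i) (toℕ j))))
      (ℕ.≤-<-trans (ℤ.∣m⊝n∣≤m⊔n (toℕ i) (toℕ j)) (ℕ.⊔-lub (Fin.toℕ<n i) (Fin.toℕ<n j)))

  residue-cong : ∀ {x y} → x ≈ y → residue x ≡ residue y
  residue-cong {x} {y} p = toℕ-injective-≈ (≈-trans (residue-≈ x) (≈-trans p (≈-sym (residue-≈ y))))

  residue-injective : ∀ {x y} → residue x ≡ residue y → x ≈ y
  residue-injective {x} {y} eq =
    ≈-trans (≈-sym (residue-≈ x)) (subst (λ i → + toℕ i ≈ y) (sym eq) (residue-≈ y))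

  residue-toℕ : ∀ i → residue (+ toℕ i) ≡ i
  residue-toℕ i = toℕ-injective-≈ (residue-≈ (+ toℕ i))

module GroupTheory {A : Set} {mul : A → A → A} {ε : A} {inverse : A → A}
                   (isGroup : IsGroup _≡_ mul ε inverse) where

  -- The operations are parameters under other names so that they can be given fixities.
  infixl 7 _∙_
  _∙_ : A → A → A
  _∙_ = mul

  infix 8 _⁻¹
  _⁻¹ : A → A
  _⁻¹ = inverse

  open IsGroup isGroup using (assoc; identityˡ; identityʳ; inverseˡ; inverseʳ)

  group : Group _ _
  group = record { isGroup = isGroup }

  open GroupProperties group public

  involution-inverse : ∀ {x} → x ∙ x ≡ ε → x ⁻¹ ≡ x
  involution-inverse {x} xx≡ε = sym (inverseˡ-unique x x xx≡ε)

  commuting-involutions : ∀ {x y} → x ∙ x ≡ ε → y ∙ y ≡ ε → x ∙ y ≡ y ∙ x → (x ∙ y) ∙ (x ∙ y) ≡ ε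
  commuting-involutions {x} {y} xx≡ε yy≡ε xy≡yx = begin
    (x ∙ y) ∙ (x ∙ y)  ≡⟨ cong ((x ∙ y) ∙_) xy≡yx ⟩
    (x ∙ y) ∙ (y ∙ x)  ≡⟨ assoc x y (y ∙ x) ⟩
    x ∙ (y ∙ (y ∙ x))  ≡⟨ cong (x ∙_) (sym (assoc y y x)) ⟩
    x ∙ ((y ∙ y) ∙ x)  ≡⟨ cong (λ z → x ∙ (z ∙ x)) yy≡ε ⟩
    x ∙ (ε ∙ x)        ≡⟨ cong (x ∙_) (identityˡ x) ⟩
    x ∙ x              ≡⟨ xx≡ε ⟩
    ε                  ∎

  homo-ε : ∀ (σ : A → A) → (∀ x y → σ (x ∙ y) ≡ σ x ∙ σ y) → σ ε ≡ ε
  homo-ε σ σ-homo = identityʳ-unique (σ ε) (σ ε) (trans (sym (σ-homo ε ε)) (cong σ (identityˡ ε)))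

  injective-homo-reflects-involution : ∀ (σ : A → A) → (∀ {x y} → σ x ≡ σ y → x ≡ y) →
    (∀ x y → σ (x ∙ y) ≡ σ x ∙ σ y) → ∀ x → σ x ∙ σ x ≡ ε → x ∙ x ≡ ε
  injective-homo-reflects-involution σ σ-injective σ-homo x σxσx≡ε =
    σ-injective (trans (σ-homo x x) (trans σxσx≡ε (sym (homo-ε σ σ-homo))))

  quotient-cancel : ∀ y u x → (y ∙ (u ∙ x) ⁻¹) ∙ u ≡ y ∙ x ⁻¹
  quotient-cancel y u x = begin
    (y ∙ (u ∙ x) ⁻¹) ∙ u        ≡⟨ cong (λ z → (y ∙ z) ∙ u) (⁻¹-anti-homo-∙ u x) ⟩
    (y ∙ (x ⁻¹ ∙ u ⁻¹)) ∙ u     ≡⟨ cong (_∙ u) (sym (assoc y (x ⁻¹) (u ⁻¹))) ⟩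
    ((y ∙ x ⁻¹) ∙ u ⁻¹) ∙ u     ≡⟨ //-rightDividesˡ u (y ∙ x ⁻¹) ⟩
    y ∙ x ⁻¹                    ∎

  conjugation-involutive : ∀ {r} → r ∙ r ≡ ε → ∀ z → r ∙ ((r ∙ (z ∙ r)) ∙ r) ≡ z
  conjugation-involutive {r} rr≡ε z = begin
    r ∙ ((r ∙ (z ∙ r)) ∙ r)  ≡⟨ cong (r ∙_) (assoc r (z ∙ r) r) ⟩
    r ∙ (r ∙ ((z ∙ r) ∙ r))  ≡⟨ sym (assoc r r _) ⟩
    (r ∙ r) ∙ ((z ∙ r) ∙ r)  ≡⟨ cong₂ _∙_ rr≡ε (assoc z r r) ⟩
    ε ∙ (z ∙ (r ∙ r))        ≡⟨ identityˡ _ ⟩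
    z ∙ (r ∙ r)              ≡⟨ cong (z ∙_) rr≡ε ⟩
    z ∙ ε                    ≡⟨ identityʳ z ⟩
    z                        ∎

  module Twist (χ : A → Bool) (χ-homo : ∀ x y → χ (x ∙ y) ≡ χ x xor χ y)
               {r : A} (rr≡ε : r ∙ r ≡ ε) (χr≡false : χ r ≡ false) where

    r^ : Bool → A
    r^ false = ε
    r^ true  = r

    r^-xor : ∀ c d → r^ (c xor d) ≡ r^ c ∙ r^ d
    r^-xor false d     = sym (identityˡ (r^ d))
    r^-xor true  false = sym (identityʳ r)
    r^-xor true  true  = sym rr≡ε

    r^-involutive : ∀ c → r^ c ∙ r^ c ≡ ε
    r^-involutive c = trans (sym (r^-xor c c)) (cong r^ (Bool.xor-same c))

    χ-ε : χ ε ≡ false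
    χ-ε = trans (cong χ (sym (identityˡ ε))) (trans (χ-homo ε ε) (Bool.xor-same (χ ε)))

    χ-r^ : ∀ c → χ (r^ c) ≡ false
    χ-r^ false = χ-ε
    χ-r^ true  = χr≡false

    χ-⁻¹ : ∀ x → χ (x ⁻¹) ≡ χ x
    χ-⁻¹ x = xor≡false⇒≡ (trans (sym (χ-homo (x ⁻¹) x)) (trans (cong χ (inverseˡ x)) χ-ε))
      where
      xor≡false⇒≡ : ∀ {c d} → c xor d ≡ false → c ≡ d
      xor≡false⇒≡ {false} {false} _ = refl
      xor≡false⇒≡ {true}  {true}  _ = refl

    twist : A → A
    twist x = r^ (χ x) ∙ x

    χ-twist : ∀ x → χ (twist x) ≡ χ x
    χ-twist x = trans (χ-homo (r^ (χ x)) x) (cong (_xor χ x) (χ-r^ (χ x)))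

    twist-involutive : ∀ x → twist (twist x) ≡ x
    twist-involutive x = begin
      r^ (χ (twist x)) ∙ (r^ (χ x) ∙ x)  ≡⟨ cong (λ c → r^ c ∙ (r^ (χ x) ∙ x)) (χ-twist x) ⟩
      r^ (χ x) ∙ (r^ (χ x) ∙ x)          ≡⟨ sym (assoc _ _ x) ⟩
      (r^ (χ x) ∙ r^ (χ x)) ∙ x          ≡⟨ cong (_∙ x) (r^-involutive (χ x)) ⟩
      ε ∙ x                              ≡⟨ identityˡ x ⟩
      x                                  ∎

    twist-ε : twist ε ≡ ε
    twist-ε = trans (cong (λ c → r^ c ∙ ε) χ-ε) (identityˡ ε)

    twist-quotient : ∀ x y → twist y ∙ twist x ⁻¹ ≡ r^ (χ y) ∙ ((y ∙ x ⁻¹) ∙ r^ (χ x))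
    twist-quotient x y = begin
      (r^ d ∙ y) ∙ (r^ c ∙ x) ⁻¹     ≡⟨ cong ((r^ d ∙ y) ∙_) (⁻¹-anti-homo-∙ (r^ c) x) ⟩
      (r^ d ∙ y) ∙ (x ⁻¹ ∙ r^ c ⁻¹)  ≡⟨ cong (λ z → (r^ d ∙ y) ∙ (x ⁻¹ ∙ z)) r^c⁻¹≡r^c ⟩
      (r^ d ∙ y) ∙ (x ⁻¹ ∙ r^ c)     ≡⟨ assoc (r^ d) y _ ⟩
      r^ d ∙ (y ∙ (x ⁻¹ ∙ r^ c))     ≡⟨ cong (r^ d ∙_) (sym (assoc y (x ⁻¹) (r^ c))) ⟩
      r^ d ∙ ((y ∙ x ⁻¹) ∙ r^ c)     ∎
      where
      c = χ x
      d = χ y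
      r^c⁻¹≡r^c : r^ c ⁻¹ ≡ r^ c
      r^c⁻¹≡r^c = involution-inverse (r^-involutive c)

    twist-twist-quotient : ∀ x y → twist (twist y ∙ twist x ⁻¹) ≡ r^ (χ x) ∙ ((y ∙ x ⁻¹) ∙ r^ (χ x))
    twist-twist-quotient x y = begin
      r^ (χ (twist y ∙ twist x ⁻¹)) ∙ (twist y ∙ twist x ⁻¹)
        ≡⟨ cong₂ (λ e z → r^ e ∙ z) χ-quotient (twist-quotient x y) ⟩
      r^ (d xor c) ∙ (r^ d ∙ w)   ≡⟨ sym (assoc _ _ w) ⟩
      (r^ (d xor c) ∙ r^ d) ∙ w   ≡⟨ cong (_∙ w) (sym (r^-xor (d xor c) d)) ⟩
      r^ ((d xor c) xor d) ∙ w    ≡⟨ cong (λ e → r^ e ∙ w) (xor-cancel d c) ⟩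
      r^ c ∙ w                    ∎
      where
      c = χ x
      d = χ y
      w = (y ∙ x ⁻¹) ∙ r^ c
      χ-quotient : χ (twist y ∙ twist x ⁻¹) ≡ d xor c
      χ-quotient = trans (χ-homo _ _) (cong₂ _xor_ (χ-twist y) (trans (χ-⁻¹ (twist x)) (χ-twist x)))
      xor-cancel : ∀ d c → (d xor c) xor d ≡ c
      xor-cancel false false = refl
      xor-cancel false true  = refl
      xor-cancel true  false = refl
      xor-cancel true  true  = refl

    twist-preserves-quotients : ∀ {B : Set} (P : A → B) → (∀ z → P (r ∙ (z ∙ r)) ≡ P z) →
      ∀ x y → P (twist (twist y ∙ twist x ⁻¹)) ≡ P (y ∙ x ⁻¹)
    twist-preserves-quotients P P-conj x y =
      trans (cong P (twist-twist-quotient x y)) (P-conj-r^ (χ x) (y ∙ x ⁻¹))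
      where
      P-conj-r^ : ∀ c z → P (r^ c ∙ (z ∙ r^ c)) ≡ P z
      P-conj-r^ false z = cong P (trans (identityˡ _) (identityʳ z))
      P-conj-r^ true  z = P-conj z

    twist-involution : ∀ {x} → x ∙ x ≡ ε → r ∙ x ≡ x ∙ r → twist x ∙ twist x ≡ ε
    twist-involution {x} xx≡ε rx≡xr = commuting-involutions (r^-involutive (χ x)) xx≡ε (commutes (χ x))
      where
      commutes : ∀ c → r^ c ∙ x ≡ x ∙ r^ c
      commutes false = trans (identityˡ x) (sym (identityʳ x))
      commutes true  = rx≡xr

  GeneratedBy : A → A → Set₁
  GeneratedBy g h = ∀ (Q : A → Set) → Q ε →
    (∀ x → Q x → Q (g ∙ x)) → (∀ x → Q x → Q (h ∙ x)) → ∀ x → Q x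

  invariant-under-generators : ∀ {g h} {B : Set} → GeneratedBy g h → (F : A → B) →
    (∀ x → F (g ∙ x) ≡ F x) → (∀ x → F (h ∙ x) ≡ F x) → ∀ x → F x ≡ F ε
  invariant-under-generators generated F Fg≡F Fh≡F =
    generated (λ x → F x ≡ F ε) refl (λ x p → trans (Fg≡F x) p) (λ x p → trans (Fh≡F x) p)

  module Displacement (f : A → A) where

    δ : A → A → A
    δ u x = f (u ∙ x) ∙ f x ⁻¹

    δ-∙ : ∀ u x → δ u x ∙ f x ≡ f (u ∙ x)
    δ-∙ u x = //-rightDividesˡ (f x) (f (u ∙ x))

    δ-cocycle : ∀ u v x → δ (u ∙ v) x ≡ δ u (v ∙ x) ∙ δ v x
    δ-cocycle u v x = begin
      f ((u ∙ v) ∙ x) ∙ f x ⁻¹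
        ≡⟨ cong (λ z → f z ∙ f x ⁻¹) (assoc u v x) ⟩
      f (u ∙ (v ∙ x)) ∙ f x ⁻¹
        ≡⟨ cong (f (u ∙ (v ∙ x)) ∙_) (sym (\\-leftDividesʳ (f (v ∙ x)) (f x ⁻¹))) ⟩
      f (u ∙ (v ∙ x)) ∙ (f (v ∙ x) ⁻¹ ∙ (f (v ∙ x) ∙ f x ⁻¹))
        ≡⟨ sym (assoc _ _ _) ⟩
      δ u (v ∙ x) ∙ δ v x
        ∎

    δ-relation : ∀ u v u′ v′ → u ∙ v ≡ u′ ∙ v′ → ∀ x → δ u (v ∙ x) ∙ δ v x ≡ δ u′ (v′ ∙ x) ∙ δ v′ x
    δ-relation u v u′ v′ uv≡u′v′ x =
      trans (sym (δ-cocycle u v x)) (trans (cong (λ w → δ w x) uv≡u′v′) (δ-cocycle u′ v′ x))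

    δ-ε : ∀ x → δ ε x ≡ ε
    δ-ε x = trans (cong (λ z → f z ∙ f x ⁻¹) (identityˡ x)) (inverseʳ (f x))

    δ-injective : (∀ {x y} → f x ≡ f y → x ≡ y) → ∀ {u v} x → δ u x ≡ δ v x → u ≡ v
    δ-injective f-injective {u} {v} x δu≡δv = ∙-cancelʳ x u v (f-injective (begin
      f (u ∙ x)      ≡⟨ sym (δ-∙ u x) ⟩
      δ u x ∙ f x    ≡⟨ cong (_∙ f x) δu≡δv ⟩
      δ v x ∙ f x    ≡⟨ δ-∙ v x ⟩
      f (v ∙ x)      ∎))

    δ-invariant : ∀ {u v} → v ∙ u ≡ ε → (∀ y → δ v y ≡ δ u y ⁻¹) → ∀ x → δ u (u ∙ x) ≡ δ u x
    δ-invariant {u} {v} vu≡ε δv≡δu⁻¹ x = ⁻¹-injective (inverseˡ-unique _ _ (begin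
      δ u (u ∙ x) ⁻¹ ∙ δ u x  ≡⟨ cong (_∙ δ u x) (sym (δv≡δu⁻¹ (u ∙ x))) ⟩
      δ v (u ∙ x) ∙ δ u x     ≡⟨ sym (δ-cocycle v u x) ⟩
      δ (v ∙ u) x             ≡⟨ cong (λ w → δ w x) vu≡ε ⟩
      δ ε x                   ≡⟨ δ-ε x ⟩
      ε                       ∎))

    δ-affine : ∀ {g h} → GeneratedBy g h → (∀ x → δ g x ≡ δ g ε) → (∀ x → δ h x ≡ δ h ε) →
      ∀ x y → f (x ∙ y) ≡ f x ∙ (f ε ⁻¹ ∙ f y)
    δ-affine {g} {h} generated δg-constant δh-constant =
      generated (λ x → ∀ y → f (x ∙ y) ≡ f x ∙ (f ε ⁻¹ ∙ f y)) base (step δg-constant) (step δh-constant)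
      where
      base : ∀ y → f (ε ∙ y) ≡ f ε ∙ (f ε ⁻¹ ∙ f y)
      base y = trans (cong f (identityˡ y)) (sym (\\-leftDividesˡ (f ε) (f y)))
      step : ∀ {u} → (∀ x → δ u x ≡ δ u ε) → ∀ x → (∀ y → f (x ∙ y) ≡ f x ∙ (f ε ⁻¹ ∙ f y)) →
        ∀ y → f ((u ∙ x) ∙ y) ≡ f (u ∙ x) ∙ (f ε ⁻¹ ∙ f y)
      step {u} δu-constant x IH y = begin
        f ((u ∙ x) ∙ y)                ≡⟨ cong f (assoc u x y) ⟩
        f (u ∙ (x ∙ y))                ≡⟨ sym (δ-∙ u (x ∙ y)) ⟩
        δ u (x ∙ y) ∙ f (x ∙ y)        ≡⟨ cong₂ _∙_ (trans (δu-constant (x ∙ y)) (sym (δu-constant x))) (IH y) ⟩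
        δ u x ∙ (f x ∙ (f ε ⁻¹ ∙ f y)) ≡⟨ sym (assoc _ _ _) ⟩
        (δ u x ∙ f x) ∙ (f ε ⁻¹ ∙ f y) ≡⟨ cong (_∙ (f ε ⁻¹ ∙ f y)) (δ-∙ u x) ⟩
        f (u ∙ x) ∙ (f ε ⁻¹ ∙ f y)     ∎

module Dihedral (n : ℕ) .{{_ : NonZero n}} where

  open Modular n

  ⟦_,_⟧ : ℤ → Bool → D n
  ⟦ x , e ⟧ = residue x , e

  ⟦⟧-cong : ∀ {x y} e → x ≈ y → ⟦ x , e ⟧ ≡ ⟦ y , e ⟧
  ⟦⟧-cong e x≈y = cong (_, e) (residue-cong x≈y)

  ⟦⟧-injective : ∀ {x y e f} → ⟦ x , e ⟧ ≡ ⟦ y , f ⟧ → x ≈ y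
  ⟦⟧-injective eq = residue-injective (cong proj₁ eq)

  ⟦⟧-toℕ : ∀ (u : D n) → ⟦ + toℕ (proj₁ u) , proj₂ u ⟧ ≡ u
  ⟦⟧-toℕ (i , e) = cong (_, e) (residue-toℕ i)

  ⟦⟧-induction : (P : D n → Set) → (∀ x e → P ⟦ x , e ⟧) → ∀ u → P u
  ⟦⟧-induction P P⟦⟧ u = subst P (⟦⟧-toℕ u) (P⟦⟧ (+ toℕ (proj₁ u)) (proj₂ u))

  addF-residue : ∀ x y → addF (residue x) (residue y) ≡ residue (x + y)
  addF-residue x y = residue-cong (+-cong-≈ (residue-≈ x) (residue-≈ y))

  negF-residue : ∀ x → negF (residue x) ≡ residue (- x)
  negF-residue x = residue-cong (≈-trans (≈-reflexive n∸i≡n-i)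
    (≈-trans (+-cong-≈ n≈0 (neg-cong-≈ (residue-≈ x))) (≈-reflexive (ℤ.+-identityˡ (- x)))))
    where
    i = residue x
    n∸i≡n-i : + (n ℕ.∸ toℕ i) ≡ + n - + toℕ i
    n∸i≡n-i = sym (trans (ℤ.m-n≡m⊖n n (toℕ i)) (ℤ.⊖-≥ (ℕ.<⇒≤ (Fin.toℕ<n i))))

  rotation-· : ∀ x y f → ⟦ x , false ⟧ · ⟦ y , f ⟧ ≡ ⟦ x + y , f ⟧
  rotation-· x y f = cong (_, f) (addF-residue x y)

  reflection-· : ∀ x y f → ⟦ x , true ⟧ · ⟦ y , f ⟧ ≡ ⟦ x - y , not f ⟧
  reflection-· x y f = cong (_, not f) (trans (cong (addF (residue x)) (negF-residue y)) (addF-residue x (- y)))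

  inv-⟦⟧ : ∀ x → inv ⟦ x , false ⟧ ≡ ⟦ - x , false ⟧
  inv-⟦⟧ x = cong (_, false) (negF-residue x)

  sign : Bool → ℤ
  sign false = 1ℤ
  sign true  = -1ℤ

  ·-⟦⟧ : ∀ x e y f → ⟦ x , e ⟧ · ⟦ y , f ⟧ ≡ ⟦ x + sign e * y , e xor f ⟧
  ·-⟦⟧ x false y f = trans (rotation-· x y f) (cong (λ z → ⟦ x + z , f ⟧) (sym (ℤ.*-identityˡ y)))
  ·-⟦⟧ x true  y f = trans (reflection-· x y f) (cong (λ z → ⟦ x + z , not f ⟧) (sym (ℤ.-1*i≡-i y)))

  ·-assoc-⟦⟧ : ∀ x e y f z g → (⟦ x , e ⟧ · ⟦ y , f ⟧) · ⟦ z , g ⟧ ≡ ⟦ x , e ⟧ · (⟦ y , f ⟧ · ⟦ z , g ⟧)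
  ·-assoc-⟦⟧ x e y f z g = begin
    (⟦ x , e ⟧ · ⟦ y , f ⟧) · ⟦ z , g ⟧                           ≡⟨ cong (_· ⟦ z , g ⟧) (·-⟦⟧ x e y f) ⟩
    ⟦ x + sign e * y , e xor f ⟧ · ⟦ z , g ⟧                        ≡⟨ ·-⟦⟧ (x + sign e * y) (e xor f) z g ⟩
    ⟦ (x + sign e * y) + sign (e xor f) * z , (e xor f) xor g ⟧     ≡⟨ cong₂ (λ s h → ⟦ (x + sign e * y) + s * z , h ⟧)
                                                                         (sign-xor e f) (Bool.xor-assoc e f g) ⟩
    ⟦ (x + sign e * y) + (sign e * sign f) * z , e xor (f xor g) ⟧  ≡⟨ cong (λ w → ⟦ w , e xor (f xor g) ⟧)
                                                                         (distribute x y z (sign e) (sign f)) ⟩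
    ⟦ x + sign e * (y + sign f * z) , e xor (f xor g) ⟧             ≡⟨ sym (·-⟦⟧ x e (y + sign f * z) (f xor g)) ⟩
    ⟦ x , e ⟧ · ⟦ y + sign f * z , f xor g ⟧                        ≡⟨ cong (⟦ x , e ⟧ ·_) (sym (·-⟦⟧ y f z g)) ⟩
    ⟦ x , e ⟧ · (⟦ y , f ⟧ · ⟦ z , g ⟧)                             ∎
    where
    sign-xor : ∀ e f → sign (e xor f) ≡ sign e * sign f
    sign-xor false f     = sym (ℤ.*-identityˡ (sign f))
    sign-xor true  false = refl
    sign-xor true  true  = refl
    distribute : ∀ x y z s t → (x + s * y) + (s * t) * z ≡ x + s * (y + t * z)
    distribute = solve-∀

  ·-assoc : ∀ u v w → (u · v) · w ≡ u · (v · w)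
  ·-assoc = ⟦⟧-induction _ λ x e → ⟦⟧-induction _ λ y f → ⟦⟧-induction _ λ z g → ·-assoc-⟦⟧ x e y f z g

  ·-identityˡ : ∀ u → one · u ≡ u
  ·-identityˡ = ⟦⟧-induction _ λ x e → trans (rotation-· 0ℤ x e) (cong (λ w → ⟦ w , e ⟧) (ℤ.+-identityˡ x))

  ·-identityʳ : ∀ u → u · one ≡ u
  ·-identityʳ = ⟦⟧-induction _ λ where
    x false → trans (rotation-· x 0ℤ false) (cong (λ w → ⟦ w , false ⟧) (ℤ.+-identityʳ x))
    x true  → trans (reflection-· x 0ℤ false) (cong (λ w → ⟦ w , true ⟧) (ℤ.+-identityʳ x))

  ·-inverseˡ : ∀ u → inv u · u ≡ one
  ·-inverseˡ = ⟦⟧-induction _ λ where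
    x false → begin
      inv ⟦ x , false ⟧ · ⟦ x , false ⟧  ≡⟨ cong (_· ⟦ x , false ⟧) (inv-⟦⟧ x) ⟩
      ⟦ - x , false ⟧ · ⟦ x , false ⟧    ≡⟨ rotation-· (- x) x false ⟩
      ⟦ - x + x , false ⟧                ≡⟨ cong (λ w → ⟦ w , false ⟧) (ℤ.+-inverseˡ x) ⟩
      one                                ∎
    x true  → trans (reflection-· x x true) (cong (λ w → ⟦ w , false ⟧) (ℤ.+-inverseʳ x))

  ·-inverseʳ : ∀ u → u · inv u ≡ one
  ·-inverseʳ = ⟦⟧-induction _ λ where
    x false → begin
      ⟦ x , false ⟧ · inv ⟦ x , false ⟧  ≡⟨ cong (⟦ x , false ⟧ ·_) (inv-⟦⟧ x) ⟩
      ⟦ x , false ⟧ · ⟦ - x , false ⟧    ≡⟨ rotation-· x (- x) false ⟩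
      ⟦ x - x , false ⟧                  ≡⟨ cong (λ w → ⟦ w , false ⟧) (ℤ.+-inverseʳ x) ⟩
      one                                ∎
    x true  → trans (reflection-· x x true) (cong (λ w → ⟦ w , false ⟧) (ℤ.+-inverseʳ x))

  isGroup : IsGroup _≡_ _·_ one inv
  isGroup = record
    { isMonoid = record
      { isSemigroup = record
        { isMagma = record { isEquivalence = isEquivalence ; ∙-cong = cong₂ _·_ }
        ; assoc   = ·-assoc
        }
      ; identity = ·-identityˡ , ·-identityʳ
      }
    ; inverse = ·-inverseˡ , ·-inverseʳ
    ; ⁻¹-cong = cong inv
    }

  open GroupTheory isGroup public

  ⟦⟧-≢ : ∀ {x y e f} → 0 ℕ.< ∣ x - y ∣ → ∣ x - y ∣ ℕ.< n → ⟦ x , e ⟧ ≢ ⟦ y , f ⟧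
  ⟦⟧-≢ {x} {y} 0<∣x-y∣ ∣x-y∣<n eq with ⟦⟧-injective {x} {y} eq
  ... | n∣- n∣x-y = ℕ.<⇒≢ 0<∣x-y∣ (sym (cong ∣_∣ (n∣x∧∣x∣<n⇒x≡0 n∣x-y ∣x-y∣<n)))

  IsReflection : D n → Set
  IsReflection u = proj₂ u ≡ true

  IsRotation : D n → Set
  IsRotation u = proj₂ u ≡ false

  proj₂-· : ∀ u v → proj₂ (u · v) ≡ proj₂ u xor proj₂ v
  proj₂-· (i , false) (j , f) = refl
  proj₂-· (i , true)  (j , f) = refl

  reflection-involutive : ∀ {t} → IsReflection t → t · t ≡ one
  reflection-involutive {t} = ⟦⟧-induction (λ t → IsReflection t → t · t ≡ one) (λ where
    x false ()
    x true  _ → trans (reflection-· x x true) (cong (λ w → ⟦ w , false ⟧) (ℤ.+-inverseʳ x))) t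

  reflection-inverts : ∀ {t u} → IsReflection t → IsRotation u → t · u ≡ inv u · t
  reflection-inverts {t} {u} = ⟦⟧-induction (λ t → IsReflection t → IsRotation u → t · u ≡ inv u · t) (λ where
    x false () _
    x true  _ → ⟦⟧-induction (λ u → IsRotation u → ⟦ x , true ⟧ · u ≡ inv u · ⟦ x , true ⟧) (λ where
      y true ()
      y false _ → begin
        ⟦ x , true ⟧ · ⟦ y , false ⟧        ≡⟨ reflection-· x y false ⟩
        ⟦ x - y , true ⟧                    ≡⟨ cong (λ w → ⟦ w , true ⟧) (ℤ.+-comm x (- y)) ⟩
        ⟦ - y + x , true ⟧                  ≡⟨ sym (rotation-· (- y) x true) ⟩
        ⟦ - y , false ⟧ · ⟦ x , true ⟧      ≡⟨ cong (_· ⟦ x , true ⟧) (sym (inv-⟦⟧ y)) ⟩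
        inv ⟦ y , false ⟧ · ⟦ x , true ⟧    ∎) u) t

  IsReflection-·-IsRotation : ∀ {t u} → IsReflection t → IsRotation u → IsReflection (t · u)
  IsReflection-·-IsRotation {t} {u} t-refl u-rot = trans (proj₂-· t u) (cong₂ _xor_ t-refl u-rot)

  IsRotation-·-IsReflection : ∀ {u t} → IsRotation u → IsReflection t → IsReflection (u · t)
  IsRotation-·-IsReflection {u} {t} u-rot t-refl = trans (proj₂-· u t) (cong₂ _xor_ u-rot t-refl)

  IsRotation-inv : ∀ {u} → IsRotation u → IsRotation (inv u)
  IsRotation-inv {i , false} refl = refl

  reflection≢rotation : ∀ {t u} → IsReflection t → IsRotation u → t ≢ u
  reflection≢rotation t-refl u-rot t≡u = Bool.not-¬ t-refl (trans (cong proj₂ t≡u) u-rot)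

  reflection-≢-one : ∀ {t} → IsReflection t → t ≢ one
  reflection-≢-one t-refl t≡one = Bool.not-¬ t-refl (cong proj₂ t≡one)

  reflection-conjugates-rotation : ∀ {t u} → IsReflection t → IsRotation u → t · (u · t) ≡ inv u
  reflection-conjugates-rotation {t} {u} t-refl u-rot = begin
    t · (u · t)        ≡⟨ sym (·-assoc t u t) ⟩
    (t · u) · t        ≡⟨ cong (_· t) (reflection-inverts t-refl u-rot) ⟩
    (inv u · t) · t    ≡⟨ ·-assoc (inv u) t t ⟩
    inv u · (t · t)    ≡⟨ cong (inv u ·_) (reflection-involutive t-refl) ⟩
    inv u · one        ≡⟨ ·-identityʳ (inv u) ⟩
    inv u              ∎

  ab : D n
  ab = a · b

  ab≡⟦1,true⟧ : ab ≡ ⟦ 1ℤ , true ⟧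
  ab≡⟦1,true⟧ = rotation-· 1ℤ 0ℤ true

  generated-by-a-ab : GeneratedBy a ab
  generated-by-a-ab Q Q-one Q-a Q-ab z = subst Q (⟦⟧-toℕ z) (reach (toℕ (proj₁ z)) (proj₂ z))
    where
    rotations : ∀ k → Q ⟦ + k , false ⟧
    rotations zero    = Q-one
    rotations (suc k) = subst Q (rotation-· 1ℤ (+ k) false) (Q-a _ (rotations k))
    reflections : ∀ k → Q ⟦ + suc k , true ⟧
    reflections zero    = subst Q (trans (cong (_· one) ab≡⟦1,true⟧) (reflection-· 1ℤ 0ℤ false)) (Q-ab one Q-one)
    reflections (suc k) = subst Q (rotation-· 1ℤ (+ suc k) true) (Q-a _ (reflections k))
    reach : ∀ k e → Q ⟦ + k , e ⟧
    reach k false = rotations k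
    reach k true  = subst Q (⟦⟧-cong true k+n≈k) (reflections (k ℕ.+ ℕ.pred n))
      where
      k+n≈k : + suc (k ℕ.+ ℕ.pred n) ≈ + k
      k+n≈k = ≈-trans (≈-reflexive (trans (cong +_ suc[k+pred[n]]≡k+n) (ℤ.pos-+ k n))) (x+n≈x (+ k))
        where
        suc[k+pred[n]]≡k+n : suc (k ℕ.+ ℕ.pred n) ≡ k ℕ.+ n
        suc[k+pred[n]]≡k+n = trans (sym (ℕ.+-suc k (ℕ.pred n))) (cong (k ℕ.+_) (ℕ.suc-pred n))

module EvenDihedral (k : ℕ) where

  m : ℕ
  m = suc (suc k)

  n : ℕ
  n = m ℕ.* 2

  instance
    n-nonZero : NonZero n
    n-nonZero = _

  open Dihedral n public
  open Modular n using (n∣-; ≈-trans; ≈-reflexive; n≈0; residue; residue-≈)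
  open Modular 2 using ()
    renaming (n∣- to 2∣-; _≈_ to _≈₂_; +-cong-≈ to +-cong-≈₂; ≈-sym to ≈₂-sym; residue to residue₂;
              residue-cong to residue₂-cong; residue-≈ to residue₂-≈)

  odd : ℤ → Bool
  odd x = toℕ (residue₂ x) ℕ.≡ᵇ 1

  odd-cong : ∀ {x y} → x ≈₂ y → odd x ≡ odd y
  odd-cong x≈y = cong (λ i → toℕ i ℕ.≡ᵇ 1) (residue₂-cong x≈y)

  odd-+ : ∀ x y → odd (x + y) ≡ odd x xor odd y
  odd-+ x y = begin
    odd (x + y)                      ≡⟨ odd-cong (+-cong-≈₂ (≈₂-sym (residue₂-≈ x)) (≈₂-sym (residue₂-≈ y))) ⟩
    odd (+ toℕ i + + toℕ j)          ≡⟨ table i j ⟩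
    odd (+ toℕ i) xor odd (+ toℕ j)  ≡⟨ cong₂ _xor_ (odd-cong (residue₂-≈ x)) (odd-cong (residue₂-≈ y)) ⟩
    odd x xor odd y                  ∎
    where
    i = residue₂ x
    j = residue₂ y
    table : ∀ (i j : Fin 2) → odd (+ toℕ i + + toℕ j) ≡ odd (+ toℕ i) xor odd (+ toℕ j)
    table zero       zero       = refl
    table zero       (suc zero) = refl
    table (suc zero) zero       = refl
    table (suc zero) (suc zero) = refl

  odd-neg : ∀ x → odd (- x) ≡ odd x
  odd-neg x = odd-cong { - x} {x} (2∣- (divides (- x) (lemma x)))
    where
    lemma : ∀ x → - x - x ≡ - x * + 2
    lemma = solve-∀

  odd-sign : ∀ e y → odd (sign e * y) ≡ odd y
  odd-sign false y = cong odd (ℤ.*-identityˡ y)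
  odd-sign true  y = trans (cong odd (ℤ.-1*i≡-i y)) (odd-neg y)

  -- χ (a^i b^e) = i + e mod 2, a homomorphism because n is even
  χ : D n → Bool
  χ (i , e) = odd (+ toℕ i) xor e

  χ-⟦⟧ : ∀ x e → χ ⟦ x , e ⟧ ≡ odd x xor e
  χ-⟦⟧ x e with residue-≈ x
  ... | n∣- n∣d = cong (_xor e) (odd-cong {+ toℕ (residue x)} {x} (2∣- (∣-trans 2∣n n∣d)))
    where
    2∣n : + 2 ∣ℤ + n
    2∣n = divides (+ m) (ℤ.pos-* m 2)

  χ-homo : ∀ u v → χ (u · v) ≡ χ u xor χ v
  χ-homo = ⟦⟧-induction _ λ x e → ⟦⟧-induction _ λ y f → begin
    χ (⟦ x , e ⟧ · ⟦ y , f ⟧)            ≡⟨ cong χ (·-⟦⟧ x e y f) ⟩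
    χ ⟦ x + sign e * y , e xor f ⟧        ≡⟨ χ-⟦⟧ (x + sign e * y) (e xor f) ⟩
    odd (x + sign e * y) xor (e xor f)    ≡⟨ cong (_xor (e xor f)) (trans (odd-+ x _) (cong (odd x xor_) (odd-sign e y))) ⟩
    (odd x xor odd y) xor (e xor f)       ≡⟨ xor-interchange (odd x) (odd y) e f ⟩
    (odd x xor e) xor (odd y xor f)       ≡⟨ sym (cong₂ _xor_ (χ-⟦⟧ x e) (χ-⟦⟧ y f)) ⟩
    χ ⟦ x , e ⟧ xor χ ⟦ y , f ⟧           ∎

  a⁻¹ : D n
  a⁻¹ = inv a

  r₁ : D n
  r₁ = ab

  r₂ : D n
  r₂ = aPow (n / 2 ℕ.+ 1) · b

  aᵐ : D n
  aᵐ = aPow m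

  r₂≡⟦m+1,true⟧ : r₂ ≡ ⟦ + suc m , true ⟧
  r₂≡⟦m+1,true⟧ = trans (rotation-· (+ (n / 2 ℕ.+ 1)) 0ℤ true)
    (cong (λ i → ⟦ + i , true ⟧) (trans (ℕ.+-identityʳ _) (trans (cong (ℕ._+ 1) (m*n/n≡m m 2)) (ℕ.+-comm m 1))))

  r₂r₁≡aᵐ : r₂ · r₁ ≡ aᵐ
  r₂r₁≡aᵐ = trans (cong₂ _·_ r₂≡⟦m+1,true⟧ ab≡⟦1,true⟧) (reflection-· (+ suc m) 1ℤ true)

  aᵐ-involutive : aᵐ · aᵐ ≡ one
  aᵐ-involutive = trans (rotation-· (+ m) (+ m) false)
    (⟦⟧-cong false (≈-trans (≈-reflexive (cong +_ (m+m≡m*2 m))) n≈0))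
    where
    m+m≡m*2 : ∀ m → m ℕ.+ m ≡ m ℕ.* 2
    m+m≡m*2 = ℕ-solve-∀

  r₁r₁≡one : r₁ · r₁ ≡ one
  r₁r₁≡one = reflection-involutive {r₁} refl

  r₂r₂≡one : r₂ · r₂ ≡ one
  r₂r₂≡one = reflection-involutive {r₂} refl

  r₁r₂≡aᵐ : r₁ · r₂ ≡ aᵐ
  r₁r₂≡aᵐ = begin
    r₁ · r₂          ≡⟨ sym (cong₂ _·_ (involution-inverse {r₁} r₁r₁≡one) (involution-inverse {r₂} r₂r₂≡one)) ⟩
    inv r₁ · inv r₂  ≡⟨ sym (⁻¹-anti-homo-∙ r₂ r₁) ⟩
    inv (r₂ · r₁)    ≡⟨ cong inv r₂r₁≡aᵐ ⟩
    inv aᵐ           ≡⟨ involution-inverse {aᵐ} aᵐ-involutive ⟩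
    aᵐ               ∎

  data Turn : Set where
    ccw cw : Turn

  rotation : Turn → D n
  rotation ccw = a
  rotation cw  = a⁻¹

  reverse : Turn → Turn
  reverse ccw = cw
  reverse cw  = ccw

  inv-rotation : ∀ τ → inv (rotation τ) ≡ rotation (reverse τ)
  inv-rotation ccw = refl
  inv-rotation cw  = ⁻¹-involutive a

  rotation-IsRotation : ∀ τ → IsRotation (rotation τ)
  rotation-IsRotation ccw = refl
  rotation-IsRotation cw  = refl

  data Axis : Set where
    ax₁ ax₂ : Axis

  reflection : Axis → D n
  reflection ax₁ = r₁
  reflection ax₂ = r₂

  reflection-IsReflection : ∀ X → IsReflection (reflection X)
  reflection-IsReflection ax₁ = refl
  reflection-IsReflection ax₂ = refl

  reflections-commute : ∀ X Y → reflection X · reflection Y ≡ reflection Y · reflection X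
  reflections-commute ax₁ ax₁ = refl
  reflections-commute ax₁ ax₂ = trans r₁r₂≡aᵐ (sym r₂r₁≡aᵐ)
  reflections-commute ax₂ ax₁ = trans r₂r₁≡aᵐ (sym r₁r₂≡aᵐ)
  reflections-commute ax₂ ax₂ = refl

  _∈S : D n → Set
  z ∈S = S₀ z ≡ true

  InS : D n → Set
  InS z = (Σ Turn λ τ → z ≡ rotation τ) ⊎ (Σ Axis λ X → z ≡ reflection X)

  eqD-sound : ∀ (u v : D n) → eqD u v ≡ true → u ≡ v
  eqD-sound (i , e) (j , f) i≡j∧e≡f with i Fin.≟ j | e Bool.≟ f
  eqD-sound (i , e) (.i , .e) _ | yes refl | yes refl = refl
  eqD-sound (i , e) (j , f) () | yes _ | no _
  eqD-sound (i , e) (j , f) () | no _ | _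

  eqD-refl : ∀ (u : D n) → eqD u u ≡ true
  eqD-refl (i , e) with i Fin.≟ i | e Bool.≟ e
  ... | yes _   | yes _   = refl
  ... | no i≢i  | _       = ⊥-elim (i≢i refl)
  ... | yes _   | no e≢e  = ⊥-elim (e≢e refl)

  S-elements : ∀ {z} → z ∈S → InS z
  S-elements {z} z∈S with ∨-elim (eqD z a) z∈S
  ... | inj₁ z≡a = inj₁ (ccw , eqD-sound z a z≡a)
  ... | inj₂ z∈S′ with ∨-elim (eqD z a⁻¹) z∈S′
  ...   | inj₁ z≡a⁻¹ = inj₁ (cw , eqD-sound z a⁻¹ z≡a⁻¹)
  ...   | inj₂ z∈S″ with ∨-elim (eqD z r₁) z∈S″
  ...     | inj₁ z≡r₁ = inj₂ (ax₁ , eqD-sound z r₁ z≡r₁)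
  ...     | inj₂ z≡r₂ = inj₂ (ax₂ , eqD-sound z r₂ z≡r₂)

  rotation-∈S : ∀ τ → rotation τ ∈S
  rotation-∈S ccw = ∨-introˡ (eqD a a⁻¹ ∨ eqD a r₁ ∨ eqD a r₂) (eqD-refl a)
  rotation-∈S cw  = ∨-introʳ (eqD a⁻¹ a) (∨-introˡ (eqD a⁻¹ r₁ ∨ eqD a⁻¹ r₂) (eqD-refl a⁻¹))

  reflection-∈S : ∀ X → reflection X ∈S
  reflection-∈S ax₁ = ∨-introʳ (eqD r₁ a) (∨-introʳ (eqD r₁ a⁻¹) (∨-introˡ (eqD r₁ r₂) (eqD-refl r₁)))
  reflection-∈S ax₂ = ∨-introʳ (eqD r₂ a) (∨-introʳ (eqD r₂ a⁻¹) (∨-introʳ (eqD r₂ r₁) (eqD-refl r₂)))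

  one≢a : one ≢ a
  one≢a = ⟦⟧-≢ {0ℤ} {1ℤ} (s≤s z≤n) (s≤s (s≤s z≤n))

  a·a≢one : a · a ≢ one
  a·a≢one a·a≡one = ⟦⟧-≢ {+ 2} {0ℤ} (s≤s z≤n) (s≤s (s≤s (s≤s z≤n)))
    (trans (sym (rotation-· 1ℤ 1ℤ false)) a·a≡one)

  one-∉S : S₀ {n} one ≡ false
  one-∉S = Bool.¬-not {S₀ {n} one} {true} one∉S
    where
    one∉S : ¬ one ∈S
    one∉S one∈S with S-elements {one} one∈S
    ... | inj₁ (ccw , one≡a)   = one≢a one≡a
    ... | inj₁ (cw  , one≡a⁻¹) = one≢a (trans (sym ε⁻¹≈ε) (trans (cong inv one≡a⁻¹) (⁻¹-involutive a)))
    ... | inj₂ (X   , one≡rX)  = reflection-≢-one {reflection X} (reflection-IsReflection X) (sym one≡rX)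

  r₁-conjugates-reflection : ∀ X → r₁ · (reflection X · r₁) ≡ reflection X
  r₁-conjugates-reflection X = begin
    r₁ · (reflection X · r₁)   ≡⟨ cong (r₁ ·_) (reflections-commute X ax₁) ⟩
    r₁ · (r₁ · reflection X)   ≡⟨ sym (·-assoc r₁ r₁ (reflection X)) ⟩
    (r₁ · r₁) · reflection X   ≡⟨ cong (_· reflection X) r₁r₁≡one ⟩
    one · reflection X         ≡⟨ ·-identityˡ (reflection X) ⟩
    reflection X               ∎

  r₁-conjugation-∈S : ∀ {z} → z ∈S → (r₁ · (z · r₁)) ∈S
  r₁-conjugation-∈S {z} z∈S with S-elements {z} z∈S
  ... | inj₁ (τ , refl) = subst _∈S (sym r₁-conjugates-rotation) (rotation-∈S (reverse τ))
    where
    r₁-conjugates-rotation : r₁ · (rotation τ · r₁) ≡ rotation (reverse τ)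
    r₁-conjugates-rotation =
      trans (reflection-conjugates-rotation {r₁} {rotation τ} refl (rotation-IsRotation τ)) (inv-rotation τ)
  ... | inj₂ (X , refl) = subst _∈S (sym (r₁-conjugates-reflection X)) (reflection-∈S X)

  S₀-r₁-conjugation : ∀ (z : D n) → S₀ (r₁ · (z · r₁)) ≡ S₀ z
  S₀-r₁-conjugation z = Bool.⇔→≡ (mk⇔
    (λ conj∈S → subst _∈S (conjugation-involutive {r₁} r₁r₁≡one z) (r₁-conjugation-∈S {r₁ · (z · r₁)} conj∈S))
    (r₁-conjugation-∈S {z}))

  χ-r₁ : χ r₁ ≡ false
  χ-r₁ = χ-homo a b

  open Twist χ χ-homo {r₁} r₁r₁≡one χ-r₁

  χ-rotation : ∀ τ → χ (rotation τ) ≡ true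
  χ-rotation ccw = refl
  χ-rotation cw  = χ-⁻¹ a

  -- the image of S₀ under twist, since twist is an involution
  T₁ : Subset
  T₁ z = S₀ (twist z)

  T₁-one : T₁ one ≡ false
  T₁-one = trans (cong S₀ twist-ε) one-∉S

  twist-CayIso : CayIso S₀ T₁
  twist-CayIso = mk↔ₛ′ twist twist twist-involutive twist-involutive ,
                 twist-preserves-quotients S₀ S₀-r₁-conjugation

  twist-rotation : ∀ τ → twist (rotation τ) ≡ r₁ · rotation τ
  twist-rotation τ = cong (λ c → r^ c · rotation τ) (χ-rotation τ)

  twist-InS-involution : ∀ {z} → InS z → twist z · twist z ≡ one
  twist-InS-involution (inj₁ (τ , refl)) = trans (cong (λ w → w · w) (twist-rotation τ))
    (reflection-involutive {r₁ · rotation τ} (IsReflection-·-IsRotation {r₁} {rotation τ} refl (rotation-IsRotation τ)))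
  twist-InS-involution (inj₂ (X , refl)) = twist-involution {reflection X}
    (reflection-involutive {reflection X} (reflection-IsReflection X)) (reflections-commute ax₁ X)

  S₀-not-CI : ¬ IsCI S₀
  S₀-not-CI S₀-CI =
    let σ , σ-homo , σ[S₀]≡T₁ = S₀-CI T₁ T₁-one twist-CayIso
        σ-injective = Injection.injective (↔⇒↣ σ)
        twist-σa∈S = trans (σ[S₀]≡T₁ a) (rotation-∈S ccw)
        σa-involution = subst (λ w → w · w ≡ one) (twist-involutive (Inverse.to σ a))
                              (twist-InS-involution (S-elements {twist (Inverse.to σ a)} twist-σa∈S))
    in a·a≢one (injective-homo-reflects-involution (Inverse.to σ) σ-injective σ-homo a σa-involution)

-- Here n = 2m with m = j + 3.
module Rigid (j : ℕ) where

  open EvenDihedral (suc j)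

  below-n : ∀ {d} → d ℕ.≤ 5 ℕ.+ j → d ℕ.< n
  below-n d≤5+j = ℕ.≤-trans (s≤s d≤5+j) (ℕ.+-monoʳ-≤ 6 (ℕ.m≤m*n j 2))

  a⁻¹≡⟦-1⟧ : a⁻¹ ≡ ⟦ -1ℤ , false ⟧
  a⁻¹≡⟦-1⟧ = inv-⟦⟧ 1ℤ

  a⁻¹a⁻¹≡⟦-2⟧ : a⁻¹ · a⁻¹ ≡ ⟦ -[1+ 1 ] , false ⟧
  a⁻¹a⁻¹≡⟦-2⟧ = trans (cong₂ _·_ a⁻¹≡⟦-1⟧ a⁻¹≡⟦-1⟧) (rotation-· -1ℤ -1ℤ false)

  a≢a⁻¹ : a ≢ a⁻¹
  a≢a⁻¹ a≡a⁻¹ = ⟦⟧-≢ {1ℤ} { -1ℤ} (s≤s z≤n) (below-n (s≤s (s≤s z≤n))) (trans a≡a⁻¹ a⁻¹≡⟦-1⟧)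

  a·a≢a⁻¹·a⁻¹ : a · a ≢ a⁻¹ · a⁻¹
  a·a≢a⁻¹·a⁻¹ eq = ⟦⟧-≢ {+ 2} { -[1+ 1 ]} (s≤s z≤n) (below-n (s≤s (s≤s (s≤s (s≤s z≤n)))))
    (trans (sym (rotation-· 1ℤ 1ℤ false)) (trans eq a⁻¹a⁻¹≡⟦-2⟧))

  one≢aᵐ : one ≢ aᵐ
  one≢aᵐ = ⟦⟧-≢ {0ℤ} {+ m} (s≤s z≤n) (below-n (ℕ.+-monoˡ-≤ j (s≤s (s≤s (s≤s z≤n)))))

  a·a≢aᵐ : a · a ≢ aᵐ
  a·a≢aᵐ eq = ⟦⟧-≢ {+ 2} {+ m} (s≤s z≤n) (below-n (s≤s (ℕ.m≤n+m j 4))) (trans (sym (rotation-· 1ℤ 1ℤ false)) eq)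

  a⁻¹·a⁻¹≢aᵐ : a⁻¹ · a⁻¹ ≢ aᵐ
  a⁻¹·a⁻¹≢aᵐ eq = ⟦⟧-≢ { -[1+ 1 ]} {+ m} (s≤s z≤n) (below-n ℕ.≤-refl) (trans (sym a⁻¹a⁻¹≡⟦-2⟧) eq)

  inv-rotation-∈S : ∀ τ → inv (rotation τ) ∈S
  inv-rotation-∈S τ = subst _∈S (sym (inv-rotation τ)) (rotation-∈S (reverse τ))

  rotation-injective : ∀ {τ τ′} → rotation τ ≡ rotation τ′ → τ ≡ τ′
  rotation-injective {ccw} {ccw} _  = refl
  rotation-injective {ccw} {cw}  eq = ⊥-elim (a≢a⁻¹ eq)
  rotation-injective {cw}  {ccw} eq = ⊥-elim (a≢a⁻¹ (sym eq))
  rotation-injective {cw}  {cw}  _  = refl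

  rotation-cases : ∀ τ τ′ → rotation τ′ ≡ rotation τ ⊎ rotation τ′ ≡ inv (rotation τ)
  rotation-cases ccw ccw = inj₁ refl
  rotation-cases ccw cw  = inj₂ refl
  rotation-cases cw  ccw = inj₂ (sym (⁻¹-involutive a))
  rotation-cases cw  cw  = inj₁ refl

  aᵐ≢rotation-quotient : ∀ τ τ′ → aᵐ ≢ rotation τ · inv (rotation τ′)
  aᵐ≢rotation-quotient ccw ccw eq = one≢aᵐ (sym (trans eq (·-inverseʳ a)))
  aᵐ≢rotation-quotient ccw cw  eq = a·a≢aᵐ (sym (trans eq (cong (a ·_) (⁻¹-involutive a))))
  aᵐ≢rotation-quotient cw  ccw eq = a⁻¹·a⁻¹≢aᵐ (sym eq)
  aᵐ≢rotation-quotient cw  cw  eq = one≢aᵐ (sym (trans eq (·-inverseʳ a⁻¹)))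

  -- every vertex x is the only common out-neighbour of u x and v x
  Separated : D n → D n → Set
  Separated u v = ∀ {s t} → s ∈S → t ∈S → s · u ≡ t · v → s · u ≡ one

  reflections-·-a-a⁻¹ : ∀ {t u} → u · t ≡ aᵐ → u · u ≡ one → t · a ≢ u · a⁻¹
  reflections-·-a-a⁻¹ {t} {u} ut≡aᵐ uu≡one ta≡ua⁻¹ = a⁻¹·a⁻¹≢aᵐ (sym (x≈z//y aᵐ a a⁻¹ (begin
    aᵐ · a         ≡⟨ cong (_· a) (sym ut≡aᵐ) ⟩
    (u · t) · a    ≡⟨ ·-assoc u t a ⟩
    u · (t · a)    ≡⟨ cong (u ·_) ta≡ua⁻¹ ⟩
    u · (u · a⁻¹)  ≡⟨ sym (·-assoc u u a⁻¹) ⟩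
    (u · u) · a⁻¹  ≡⟨ cong (_· a⁻¹) uu≡one ⟩
    one · a⁻¹      ≡⟨ ·-identityˡ a⁻¹ ⟩
    a⁻¹            ∎)))

  a-a⁻¹-separated-InS : ∀ {s t} → InS s → InS t → s · a ≡ t · a⁻¹ → s · a ≡ one
  a-a⁻¹-separated-InS (inj₁ (cw , refl))  _                   _  = ·-inverseˡ a
  a-a⁻¹-separated-InS (inj₁ (ccw , refl)) (inj₁ (ccw , refl)) eq = trans eq (·-inverseʳ a)
  a-a⁻¹-separated-InS (inj₁ (ccw , refl)) (inj₁ (cw , refl))  eq = ⊥-elim (a·a≢a⁻¹·a⁻¹ eq)
  a-a⁻¹-separated-InS (inj₁ (ccw , refl)) (inj₂ (Y , refl))   eq =
    ⊥-elim (reflection≢rotation {reflection Y · a⁻¹} {a · a}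
      (IsReflection-·-IsRotation {reflection Y} (reflection-IsReflection Y) refl) refl (sym eq))
  a-a⁻¹-separated-InS (inj₂ (X , refl))   (inj₁ (τ , refl))   eq =
    ⊥-elim (reflection≢rotation {reflection X · a} {rotation τ · a⁻¹}
      (IsReflection-·-IsRotation {reflection X} (reflection-IsReflection X) refl)
      (trans (proj₂-· (rotation τ) a⁻¹) (cong (_xor false) (rotation-IsRotation τ))) eq)
  a-a⁻¹-separated-InS (inj₂ (ax₁ , refl)) (inj₂ (ax₁ , refl)) eq = ⊥-elim (a≢a⁻¹ (∙-cancelˡ r₁ a a⁻¹ eq))
  a-a⁻¹-separated-InS (inj₂ (ax₂ , refl)) (inj₂ (ax₂ , refl)) eq = ⊥-elim (a≢a⁻¹ (∙-cancelˡ r₂ a a⁻¹ eq))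
  a-a⁻¹-separated-InS (inj₂ (ax₁ , refl)) (inj₂ (ax₂ , refl)) eq = ⊥-elim (reflections-·-a-a⁻¹ {r₁} {r₂} r₂r₁≡aᵐ r₂r₂≡one eq)
  a-a⁻¹-separated-InS (inj₂ (ax₂ , refl)) (inj₂ (ax₁ , refl)) eq = ⊥-elim (reflections-·-a-a⁻¹ {r₂} {r₁} r₁r₂≡aᵐ r₁r₁≡one eq)

  a-a⁻¹-separated : Separated a a⁻¹
  a-a⁻¹-separated {s} {t} s∈S t∈S = a-a⁻¹-separated-InS (S-elements {s} s∈S) (S-elements {t} t∈S)

  separated-InS⇒rotations : ∀ {s t} → InS s → InS t → s ≢ t → Separated s t →
    Σ Turn λ τ → s ≡ rotation τ × t ≡ inv s
  separated-InS⇒rotations (inj₁ (ccw , refl)) (inj₁ (ccw , refl)) s≢t _ = ⊥-elim (s≢t refl)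
  separated-InS⇒rotations (inj₁ (ccw , refl)) (inj₁ (cw , refl))  _   _ = ccw , refl , refl
  separated-InS⇒rotations (inj₁ (cw , refl))  (inj₁ (ccw , refl)) _   _ = cw , refl , sym (⁻¹-involutive a)
  separated-InS⇒rotations (inj₁ (cw , refl))  (inj₁ (cw , refl))  s≢t _ = ⊥-elim (s≢t refl)
  separated-InS⇒rotations (inj₁ (τ , refl)) (inj₂ (Y , refl)) _ separated =
    ⊥-elim (reflection-≢-one {reflection Y · rotation τ} (IsReflection-·-IsRotation {reflection Y} rY-refl rτ-rot)
      (separated (reflection-∈S Y) (inv-rotation-∈S τ) (reflection-inverts {reflection Y} {rotation τ} rY-refl rτ-rot)))
    where
    rY-refl = reflection-IsReflection Y
    rτ-rot = rotation-IsRotation τ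
  separated-InS⇒rotations (inj₂ (X , refl)) (inj₁ (τ , refl)) _ separated =
    ⊥-elim (reflection-≢-one {inv (rotation τ) · reflection X}
      (IsRotation-·-IsReflection {inv (rotation τ)} (IsRotation-inv {rotation τ} rτ-rot) rX-refl)
      (separated (inv-rotation-∈S τ) (reflection-∈S X) (sym (reflection-inverts {reflection X} {rotation τ} rX-refl rτ-rot))))
    where
    rX-refl = reflection-IsReflection X
    rτ-rot = rotation-IsRotation τ
  separated-InS⇒rotations (inj₂ (ax₁ , refl)) (inj₂ (ax₁ , refl)) s≢t _ = ⊥-elim (s≢t refl)
  separated-InS⇒rotations (inj₂ (ax₂ , refl)) (inj₂ (ax₂ , refl)) s≢t _ = ⊥-elim (s≢t refl)
  separated-InS⇒rotations (inj₂ (ax₁ , refl)) (inj₂ (ax₂ , refl)) _ separated = ⊥-elim (one≢aᵐ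
    (trans (sym (separated {r₂} {r₁} (reflection-∈S ax₂) (reflection-∈S ax₁) (trans r₂r₁≡aᵐ (sym r₁r₂≡aᵐ)))) r₂r₁≡aᵐ))
  separated-InS⇒rotations (inj₂ (ax₂ , refl)) (inj₂ (ax₁ , refl)) _ separated = ⊥-elim (one≢aᵐ
    (trans (sym (separated {r₁} {r₂} (reflection-∈S ax₁) (reflection-∈S ax₂) (trans r₁r₂≡aᵐ (sym r₂r₁≡aᵐ)))) r₁r₂≡aᵐ))

  same-axis : ∀ {t} τ τ′ → inv (rotation τ) · t ≡ inv (rotation τ′) · t → τ′ ≡ τ
  same-axis {t} τ τ′ eq = sym (rotation-injective (⁻¹-injective (∙-cancelʳ t _ _ eq)))

  distinct-axes : ∀ {t u} τ τ′ → u · t ≡ aᵐ → t · t ≡ one → inv (rotation τ) · u ≢ inv (rotation τ′) · t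
  distinct-axes {t} {u} τ τ′ ut≡aᵐ tt≡one eq = aᵐ≢rotation-quotient τ τ′ (begin
    aᵐ                                           ≡⟨ sym ut≡aᵐ ⟩
    u · t                                        ≡⟨ y≈x\\z (inv (rotation τ)) (u · t) (inv (rotation τ′)) cancelled ⟩
    inv (inv (rotation τ)) · inv (rotation τ′)   ≡⟨ cong (_· inv (rotation τ′)) (⁻¹-involutive (rotation τ)) ⟩
    rotation τ · inv (rotation τ′)               ∎)
    where
    cancelled : inv (rotation τ) · (u · t) ≡ inv (rotation τ′)
    cancelled = begin
      inv (rotation τ) · (u · t)    ≡⟨ sym (·-assoc _ u t) ⟩
      (inv (rotation τ) · u) · t    ≡⟨ cong (_· t) eq ⟩
      (inv (rotation τ′) · t) · t   ≡⟨ ·-assoc _ t t ⟩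
      inv (rotation τ′) · (t · t)   ≡⟨ cong (inv (rotation τ′) ·_) tt≡one ⟩
      inv (rotation τ′) · one       ≡⟨ ·-identityʳ _ ⟩
      inv (rotation τ′)             ∎

  reflection-rotation-square : ∀ X Y τ τ′ → reflection Y · rotation τ ≡ inv (rotation τ′) · reflection X →
    Y ≡ X × τ′ ≡ τ
  reflection-rotation-square X Y τ τ′ eq = by-axes X Y
    (trans (sym (reflection-inverts {reflection Y} {rotation τ} (reflection-IsReflection Y) (rotation-IsRotation τ))) eq)
    where
    by-axes : ∀ X Y → inv (rotation τ) · reflection Y ≡ inv (rotation τ′) · reflection X → Y ≡ X × τ′ ≡ τ
    by-axes ax₁ ax₁ eq′ = refl , same-axis τ τ′ eq′
    by-axes ax₂ ax₂ eq′ = refl , same-axis τ τ′ eq′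
    by-axes ax₁ ax₂ eq′ = ⊥-elim (distinct-axes {r₁} {r₂} τ τ′ r₂r₁≡aᵐ r₁r₁≡one eq′)
    by-axes ax₂ ax₁ eq′ = ⊥-elim (distinct-axes {r₂} {r₁} τ τ′ r₁r₂≡aᵐ r₂r₂≡one eq′)

  module CayleyAutomorphism (φ : D n ↔ D n) (φ-aut : IsCayAut S₀ φ) where

    f : D n → D n
    f = Inverse.to φ

    f⁻¹ : D n → D n
    f⁻¹ = Inverse.from φ

    f-injective : ∀ {x y} → f x ≡ f y → x ≡ y
    f-injective = Injection.injective (↔⇒↣ φ)

    f∘f⁻¹ : ∀ y → f (f⁻¹ y) ≡ y
    f∘f⁻¹ = Inverse.strictlyInverseˡ φ

    open Displacement f

    δ-∈S : ∀ {s} → s ∈S → ∀ x → δ s x ∈S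
    δ-∈S {s} s∈S x = trans (φ-aut x (s · x)) (trans (cong S₀ (//-rightDividesʳ x s)) s∈S)

    δ-separated : ∀ {u v} → Separated u v → ∀ x → Separated (δ u x) (δ v x)
    δ-separated {u} {v} u-v-separated x {s} {t} s∈S t∈S eq =
      ∙-cancelʳ (f x) (s · δ u x) one (trans w≡fx (sym (·-identityˡ (f x))))
      where
      w : D n
      w = (s · δ u x) · f x
      w≡s·f[ux] : w ≡ s · f (u · x)
      w≡s·f[ux] = trans (·-assoc s (δ u x) (f x)) (cong (s ·_) (δ-∙ u x))
      w≡t·f[vx] : w ≡ t · f (v · x)
      w≡t·f[vx] = trans (cong (_· f x) eq) (trans (·-assoc t (δ v x) (f x)) (cong (t ·_) (δ-∙ v x)))
      y : D n
      y = f⁻¹ w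
      arc-to-y : ∀ {z r} → r ∈S → w ≡ r · f z → (y · inv z) ∈S
      arc-to-y {z} {r} r∈S w≡r·fz = trans (sym (φ-aut z y))
        (trans (cong (λ v → S₀ (v · inv (f z))) (trans (f∘f⁻¹ w) w≡r·fz))
               (trans (cong S₀ (//-rightDividesʳ (f z) r)) r∈S))
      y≡x : y ≡ x
      y≡x = x∙y⁻¹≈ε⇒x≈y y x (trans (sym (quotient-cancel y u x))
        (u-v-separated (arc-to-y s∈S w≡s·f[ux]) (arc-to-y t∈S w≡t·f[vx])
          (trans (quotient-cancel y u x) (sym (quotient-cancel y v x)))))
      w≡fx : w ≡ f x
      w≡fx = trans (sym (f∘f⁻¹ w)) (cong f y≡x)

    δ-a-rotation : ∀ x → Σ Turn λ τ → δ a x ≡ rotation τ × δ a⁻¹ x ≡ inv (δ a x)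
    δ-a-rotation x = separated-InS⇒rotations
      (S-elements {δ a x} (δ-∈S {a} (rotation-∈S ccw) x)) (S-elements {δ a⁻¹ x} (δ-∈S {a⁻¹} (rotation-∈S cw) x))
      (λ eq → a≢a⁻¹ (δ-injective f-injective x eq)) (δ-separated a-a⁻¹-separated x)

    δ-r₁-reflection : ∀ x → Σ Axis λ X → δ r₁ x ≡ reflection X
    δ-r₁-reflection x = not-rotation (S-elements {δ r₁ x} (δ-∈S {r₁} (reflection-∈S ax₁) x))
      where
      not-rotation : InS (δ r₁ x) → Σ Axis λ X → δ r₁ x ≡ reflection X
      not-rotation (inj₂ X,eq) = X,eq
      not-rotation (inj₁ (τ′ , δr₁≡rτ′)) =
        let τ , δa≡rτ , δa⁻¹≡[δa]⁻¹ = δ-a-rotation x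
            δ-r₁≢δ-rotation : ∀ {u} → rotation τ′ ≡ δ u x → IsRotation u → ⊥
            δ-r₁≢δ-rotation {u} rτ′≡δu u-rot =
              reflection≢rotation {r₁} {u} refl u-rot (δ-injective f-injective x (trans δr₁≡rτ′ rτ′≡δu))
        in ⊥-elim ([ (λ rτ′≡rτ → δ-r₁≢δ-rotation {a} (trans rτ′≡rτ (sym δa≡rτ)) refl)
                   , (λ rτ′≡rτ⁻¹ → δ-r₁≢δ-rotation {a⁻¹} (trans rτ′≡rτ⁻¹ (sym (trans δa⁻¹≡[δa]⁻¹ (cong inv δa≡rτ)))) refl)
                   ]′ (rotation-cases τ τ′))

    δ-r₁-involution : ∀ x → δ r₁ x · δ r₁ x ≡ one
    δ-r₁-involution x =
      let X , δr₁≡rX = δ-r₁-reflection x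
      in reflection-involutive {δ r₁ x} (trans (cong proj₂ δr₁≡rX) (reflection-IsReflection X))

    δ-a-invariant-a : ∀ x → δ a (a · x) ≡ δ a x
    δ-a-invariant-a = δ-invariant {a} {a⁻¹} (·-inverseˡ a) (λ y → proj₂ (proj₂ (δ-a-rotation y)))

    δ-r₁-invariant-r₁ : ∀ x → δ r₁ (r₁ · x) ≡ δ r₁ x
    δ-r₁-invariant-r₁ = δ-invariant {r₁} {r₁} r₁r₁≡one (λ y → sym (involution-inverse {δ r₁ y} (δ-r₁-involution y)))

    mixed-invariance : ∀ x → δ r₁ (a · x) ≡ δ r₁ x × δ a (r₁ · x) ≡ δ a x
    mixed-invariance x =
      let τ , δa≡rτ , _ = δ-a-rotation x
          τ′ , δa′≡rτ′ , δa⁻¹′≡[δa′]⁻¹ = δ-a-rotation (r₁ · x)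
          X , δr₁≡rX = δ-r₁-reflection x
          Y , δr₁′≡rY = δ-r₁-reflection (a · x)
          Y≡X , τ′≡τ = reflection-rotation-square X Y τ τ′ (begin
            reflection Y · rotation τ          ≡⟨ sym (cong₂ _·_ δr₁′≡rY δa≡rτ) ⟩
            δ r₁ (a · x) · δ a x               ≡⟨ δ-relation r₁ a a⁻¹ r₁ (reflection-inverts {r₁} {a} refl refl) x ⟩
            δ a⁻¹ (r₁ · x) · δ r₁ x            ≡⟨ cong₂ _·_ (trans δa⁻¹′≡[δa′]⁻¹ (cong inv δa′≡rτ′)) δr₁≡rX ⟩
            inv (rotation τ′) · reflection X   ∎)
      in trans δr₁′≡rY (trans (cong reflection Y≡X) (sym δr₁≡rX)) ,
         trans δa′≡rτ′ (trans (cong rotation τ′≡τ) (sym δa≡rτ))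

    f-affine : ∀ x y → f (x · y) ≡ f x · (inv (f one) · f y)
    f-affine = δ-affine {a} {r₁} generated-by-a-ab
      (invariant-under-generators {a} {r₁} generated-by-a-ab (δ a) δ-a-invariant-a (λ x → proj₂ (mixed-invariance x)))
      (invariant-under-generators {a} {r₁} generated-by-a-ab (δ r₁) (λ x → proj₁ (mixed-invariance x)) δ-r₁-invariant-r₁)

  S₀-regular-normal : RegularNormal S₀
  S₀-regular-normal φ φ-aut g = inv (f one) · f g , λ x → begin
    f (f⁻¹ x · g)                    ≡⟨ f-affine (f⁻¹ x) g ⟩
    f (f⁻¹ x) · (inv (f one) · f g)  ≡⟨ cong (_· (inv (f one) · f g)) (f∘f⁻¹ x) ⟩
    x · (inv (f one) · f g)          ∎
    where open CayleyAutomorphism φ φ-aut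

lemma4p1 : (n : ℕ) .{{_ : NonZero n}} → 4 ≤ n → 2 ∣ n →
    ¬ IsCI {n} S₀ × (4 < n → RegularNormal {n} S₀)
lemma4p1 _ ()             (divides zero                refl)
lemma4p1 _ (s≤s (s≤s ())) (divides (suc zero)          refl)
lemma4p1 _ _              (divides (suc (suc zero))    refl) =
  EvenDihedral.S₀-not-CI zero , λ { (s≤s (s≤s (s≤s (s≤s ())))) }
lemma4p1 _ _              (divides (suc (suc (suc j))) refl) =
  EvenDihedral.S₀-not-CI (suc j) , λ _ → Rigid.S₀-regular-normal j
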